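{- Let $\mathcal{P}$ and $\mathcal{Q}$ be ranked finite posets. Then $\mathcal{M}(\mathcal{P}\times\mathcal{Q},t)=\mathcal{M}(\mathcal{P},t)\,\mathcal{M}(\mathcal{Q},t)$.
   Context: For a ranked finite poset $\mathcal{S}$ with rank function $\mathrm{rk}$ and rank $\mathrm{rk}(\mathcal{S})$, $\mathcal{F}l^3(\mathcal{S})=\{(x,y,z):x\le y\le z\}$, $J$ is defined on $\mathcal{F}l^3(\mathcal{S})$ by $\sum_{x\le a\le y\le b\le z}J(a,y,b)=\delta_3(x,y,z)$ ($\delta_3(x,y,z)=1$ iff $x=y=z$, else $0$), and $\mathcal{M}(\mathcal{S},t)=\sum_{(x,y,z)\in\mathcal{F}l^3(\mathcal{S})}J(x,y,z)\,t^{3\mathrm{rk}(\mathcal{S})-\mathrm{rk}(x)-\mathrm{rk}(y)-\mathrm{rk}(z)}$. The product poset $\mathcal{P}\times\mathcal{Q}$ has the componentwise order and rank $\mathrm{rk}(p,q)=\mathrm{rk}(p)+\mathrm{rk}(q)$. -}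

module Defs where

open import Level using (0ℓ)
open import Data.Nat as ℕ using (ℕ; zero; suc; _∸_; _⊔_)
open import Data.Integer as ℤ using (ℤ; 0ℤ; 1ℤ)
open import Data.Fin using (Fin; remQuot)
open import Data.Fin.Properties using (_≟_)
open import Data.Product using (_×_; _,_; proj₁; proj₂)
open import Data.Vec.Functional using (foldr)
open import Relation.Nullary using (¬_; Dec; yes; no; does)
open import Relation.Nullary.Decidable using (_×-dec_)
open import Data.Bool using (Bool; true; false; if_then_else_; _∧_)
open import Relation.Binary using (Decidable; IsPartialOrder)
open import Relation.Binary.PropositionalEquality using (_≡_)

record FinPosetData : Set₁ where
  field
    size : ℕ
    _≤_  : Fin size → Fin size → Set
    _≤?_ : Decidable _≤_
    rk   : Fin size → ℕ

module _ (S : FinPosetData) where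
  open FinPosetData S

  _<_ : Fin size → Fin size → Set
  x < y = x ≤ y × ¬ (x ≡ y)

  _⋖_ : Fin size → Fin size → Set
  x ⋖ y = x < y × (∀ z → ¬ (x < z × z < y))

  Minimal : Fin size → Set
  Minimal x = ∀ z → z ≤ x → z ≡ x

  IsRankedPoset : Set
  IsRankedPoset =
    IsPartialOrder _≡_ _≤_
    × (∀ x → Minimal x → rk x ≡ 0)
    × (∀ x y → x ⋖ y → rk y ≡ suc (rk x))

  rank : ℕ
  rank = foldr _⊔_ 0 rk

  private
    ind : Bool → ℤ
    ind b = if b then 1ℤ else 0ℤ

  Σ : (Fin size → ℤ) → ℤ
  Σ f = foldr ℤ._+_ 0ℤ f

  δ₃ : Fin size → Fin size → Fin size → ℤ
  δ₃ x y z = ind (does (x ≟ y) ∧ does (y ≟ z))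

  IsJ : (Fin size → Fin size → Fin size → ℤ) → Set
  IsJ J = ∀ x y z → x ≤ y → y ≤ z →
    Σ (λ a → Σ (λ b →
      ind (does (x ≤? a) ∧ does (a ≤? y) ∧ does (y ≤? b) ∧ does (b ≤? z))
        ℤ.* J a y b))
    ≡ δ₃ x y z

  -- Polynomials in t with integer coefficients are represented by their
  -- coefficient functions ℕ → ℤ.
  M : (Fin size → Fin size → Fin size → ℤ) → ℕ → ℤ
  M J k = Σ (λ x → Σ (λ y → Σ (λ z →
    ind (does (x ≤? y) ∧ does (y ≤? z)
         ∧ does (k ℕ.≟ (3 ℕ.* rank ∸ (rk x ℕ.+ rk y ℕ.+ rk z))))
      ℤ.* J x y z)))

sumUpTo : ℕ → (ℕ → ℤ) → ℤ
sumUpTo zero    f = f 0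
sumUpTo (suc n) f = sumUpTo n f ℤ.+ f (suc n)

_⊛_ : (ℕ → ℤ) → (ℕ → ℤ) → (ℕ → ℤ)
(p ⊛ q) k = sumUpTo k (λ i → p i ℤ.* q (k ∸ i))

_⊗_ : FinPosetData → FinPosetData → FinPosetData
P ⊗ Q = record
  { size = P.size ℕ.* Q.size
  ; _≤_  = λ u v → (P._≤_ (p u) (p v)) × (Q._≤_ (q u) (q v))
  ; _≤?_ = λ u v → (P._≤?_ (p u) (p v)) ×-dec (Q._≤?_ (q u) (q v))
  ; rk   = λ u → P.rk (p u) ℕ.+ Q.rk (q u)
  }
  where
    module P = FinPosetData P
    module Q = FinPosetData Q
    p = λ u → proj₁ (remQuot {P.size} Q.size u)
    q = λ u → proj₂ (remQuot {P.size} Q.size u)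

-- The kernel J is determined on flags by its defining relation: the relation at
-- (x, y, z) involves J(x, y, z) itself plus values J(a, y, b) on flags with a
-- strictly smaller interval [a, y] or [y, b], so J is unique by induction on
-- |[x, y]| + |[y, z]|.  In P × Q intervals, the order and δ₃ all factor
-- componentwise, so J_P(x₁, y₁, z₁) J_Q(x₂, y₂, z₂) satisfies the relation of
-- P × Q and therefore is J_{P×Q}.  Ranks are additive as well, so every flag of
-- P × Q contributes to M(P × Q, t) the product of the monomials of its two
-- component flags, and M factors.
module Submission where

open import Defs
open import Level using (0ℓ)
open import Algebra.Bundles using (CommutativeMonoid)
open import Data.Bool using (Bool; true; false; if_then_else_; _∧_)
open import Data.Bool.Properties using (∧-assoc; ∧-commutativeMonoid)
open import Data.Fin as Fin using (Fin; zero; suc; toℕ; fromℕ<; combine; remQuot; punchIn; _↑ˡ_; _↑ʳ_)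
open import Data.Fin.Properties
  using (_≟_; toℕ-fromℕ; toℕ-fromℕ<; toℕ-inject₁; toℕ-injective; toℕ≤pred[n]; punchInᵢ≢i; remQuot-combine; combine-remQuot)
open import Data.Fin.Subset using (Subset; _∈_; _⊆_; _⊂_; ∣_∣)
open import Data.Fin.Subset.Properties using (p⊆q⇒∣p∣≤∣q∣; p⊂q⇒∣p∣<∣q∣)
open import Data.Integer using (ℤ; 0ℤ; 1ℤ; _+_; _*_)
import Data.Integer.Properties as ℤ
open import Data.Integer.Tactic.RingSolver using (solve-∀)
open import Data.Nat as ℕ using (ℕ; _∸_; _⊔_)
import Data.Nat.Properties as ℕ
import Data.Nat.Tactic.RingSolver as ℕ-Solver
open import Data.Nat.Induction using (<-wellFounded)
open import Data.Product using (_×_; _,_; proj₁; proj₂; ∃; uncurry)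
open import Data.Product.Properties using (×-≡,≡→≡)
open import Data.Sum using (_⊎_; inj₁; inj₂)
open import Data.Vec using (tabulate)
open import Data.Vec.Properties using (lookup∘tabulate; []=⇒lookup; lookup⇒[]=)
open import Data.Vec.Functional using (foldr)
open import Function using (_∘_; _on_; _⇔_; mk⇔; Equivalence)
open import Induction.WellFounded using (WfRec; module All)
open import Relation.Binary using (IsPartialOrder)
import Relation.Binary.Construct.On as On
open import Relation.Binary.PropositionalEquality
open import Relation.Nullary using (Dec; yes; no; does; _×-dec_)
open import Relation.Nullary.Decidable using (dec-true; dec-false; does-⇔)

open import Algebra.Properties.Semiring.Sum ℤ.+-*-semiring
  using (sum; sum-cong-≗; sum-replicate-zero; sum-remove; sum-init-last; ∑-comm; *-distribˡ-sum; *-distribʳ-sum)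
open import Algebra.Properties.AbelianGroup ℤ.+-0-abelianGroup using (∙-cancelʳ)
open import Algebra.Properties.CommutativeSemigroup ℤ.*-commutativeSemigroup
  using (xy∙z≈y∙xz) renaming (interchange to *-interchange)
open import Algebra.Properties.CommutativeSemigroup (CommutativeMonoid.commutativeSemigroup ∧-commutativeMonoid)
  using () renaming (interchange to ∧-interchange)

open ≡-Reasoning

sum-zero : ∀ {n} {f : Fin n → ℤ} → (∀ i → f i ≡ 0ℤ) → sum f ≡ 0ℤ
sum-zero {n} f≗0 = trans (sum-cong-≗ f≗0) (sum-replicate-zero n)

sum-single : ∀ {n} (f : Fin n → ℤ) x → (∀ i → i ≢ x → f i ≡ 0ℤ) → sum f ≡ f x
sum-single {ℕ.suc n} f x f≗0 = begin
  sum f                     ≡⟨ sum-remove {i = x} f ⟩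
  f x + sum (f ∘ punchIn x) ≡⟨ cong (f x +_) (sum-zero (λ j → f≗0 _ (punchInᵢ≢i x j))) ⟩
  f x + 0ℤ                  ≡⟨ ℤ.+-identityʳ (f x) ⟩
  f x                       ∎

sum≡sum⇒≡-at : ∀ {n} (f g : Fin n → ℤ) x → (∀ i → i ≢ x → f i ≡ g i) → sum f ≡ sum g → f x ≡ g x
sum≡sum⇒≡-at {ℕ.suc n} f g x f≗g Σf≡Σg = ∙-cancelʳ (sum (g ∘ punchIn x)) (f x) (g x) (begin
  f x + sum (g ∘ punchIn x) ≡⟨ cong (f x +_) (sum-cong-≗ (λ j → f≗g _ (punchInᵢ≢i x j))) ⟨
  f x + sum (f ∘ punchIn x) ≡⟨ sum-remove {i = x} f ⟨
  sum f                     ≡⟨ Σf≡Σg ⟩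
  sum g                     ≡⟨ sum-remove {i = x} g ⟩
  g x + sum (g ∘ punchIn x) ∎)

sum-*-sum : ∀ {m n} (f : Fin m → ℤ) (g : Fin n → ℤ) → sum f * sum g ≡ sum λ i → sum λ j → f i * g j
sum-*-sum f g = trans (*-distribʳ-sum (sum g) f) (sum-cong-≗ λ i → *-distribˡ-sum (f i) g)

sum-↑ : ∀ m {n} (f : Fin (m ℕ.+ n) → ℤ) → sum f ≡ sum (λ i → f (i ↑ˡ n)) + sum (λ j → f (m ↑ʳ j))
sum-↑ ℕ.zero    f = sym (ℤ.+-identityˡ (sum f))
sum-↑ (ℕ.suc m) f = trans (cong (f zero +_) (sum-↑ m (f ∘ suc))) (sym (ℤ.+-assoc (f zero) _ _))

sum-combine : ∀ m n (f : Fin (m ℕ.* n) → ℤ) → sum f ≡ sum λ (i : Fin m) → sum λ (j : Fin n) → f (combine i j)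
sum-combine ℕ.zero    n f = refl
sum-combine (ℕ.suc m) n f =
  trans (sum-↑ n f) (cong (sum (λ j → f (j ↑ˡ m ℕ.* n)) +_) (sum-combine m n (λ u → f (n ↑ʳ u))))

∑³ : ∀ {n} → (Fin n → Fin n → Fin n → ℤ) → ℤ
∑³ f = sum λ x → sum λ y → sum λ z → f x y z

∑³-cong : ∀ {n} {f g : Fin n → Fin n → Fin n → ℤ} → (∀ x y z → f x y z ≡ g x y z) → ∑³ f ≡ ∑³ g
∑³-cong f≗g = sum-cong-≗ λ x → sum-cong-≗ λ y → sum-cong-≗ λ z → f≗g x y z

module _ {m n : ℕ} where

  π₁ : Fin (m ℕ.* n) → Fin m
  π₁ u = proj₁ (remQuot {m} n u)

  π₂ : Fin (m ℕ.* n) → Fin n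
  π₂ u = proj₂ (remQuot {m} n u)

  sum-remQuot : (F : Fin m → Fin n → ℤ) → sum (λ u → F (π₁ u) (π₂ u)) ≡ sum λ i → sum λ j → F i j
  sum-remQuot F = trans (sum-combine m n (λ u → F (π₁ u) (π₂ u)))
    (sum-cong-≗ λ i → sum-cong-≗ λ j → cong (uncurry F) (remQuot-combine i j))

  -- Interleaved, so that both splitting Fin (m * n) and multiplying two triple
  -- sums land on it without any reordering.
  ∑³⊗ : (Fin m → Fin m → Fin m → Fin n → Fin n → Fin n → ℤ) → ℤ
  ∑³⊗ F = sum λ x → sum λ x′ → sum λ y → sum λ y′ → sum λ z → sum λ z′ → F x y z x′ y′ z′

  ∑³⊗-cong : ∀ {F G : Fin m → Fin m → Fin m → Fin n → Fin n → Fin n → ℤ} →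
    (∀ x y z x′ y′ z′ → F x y z x′ y′ z′ ≡ G x y z x′ y′ z′) → ∑³⊗ F ≡ ∑³⊗ G
  ∑³⊗-cong F≗G = sum-cong-≗ λ x → sum-cong-≗ λ x′ → sum-cong-≗ λ y → sum-cong-≗ λ y′ →
    sum-cong-≗ λ z → sum-cong-≗ λ z′ → F≗G x y z x′ y′ z′

  ∑³-remQuot : (F : Fin m → Fin m → Fin m → Fin n → Fin n → Fin n → ℤ) →
    ∑³ (λ u v w → F (π₁ u) (π₁ v) (π₁ w) (π₂ u) (π₂ v) (π₂ w)) ≡ ∑³⊗ F
  ∑³-remQuot F = begin
    ∑³ (λ u v w → F (π₁ u) (π₁ v) (π₁ w) (π₂ u) (π₂ v) (π₂ w))
      ≡⟨ sum-cong-≗ (λ u → sum-cong-≗ λ v → sum-remQuot λ z z′ → F (π₁ u) (π₁ v) z (π₂ u) (π₂ v) z′) ⟩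
    sum (λ u → sum λ v → sum λ z → sum λ z′ → F (π₁ u) (π₁ v) z (π₂ u) (π₂ v) z′)
      ≡⟨ sum-cong-≗ (λ u → sum-remQuot λ y y′ → sum λ z → sum λ z′ → F (π₁ u) y z (π₂ u) y′ z′) ⟩
    sum (λ u → sum λ y → sum λ y′ → sum λ z → sum λ z′ → F (π₁ u) y z (π₂ u) y′ z′)
      ≡⟨ sum-remQuot (λ x x′ → sum λ y → sum λ y′ → sum λ z → sum λ z′ → F x y z x′ y′ z′) ⟩
    ∑³⊗ F ∎

-- Definitionally the (private) indicator used in Defs.
𝟙 : Bool → ℤ
𝟙 b = if b then 1ℤ else 0ℤ

𝟙-∧ : ∀ a b → 𝟙 (a ∧ b) ≡ 𝟙 a * 𝟙 b
𝟙-∧ true  b = sym (ℤ.*-identityˡ (𝟙 b))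
𝟙-∧ false b = refl

𝟙-∧-*-interchange : ∀ a b (u v : ℤ) → 𝟙 (a ∧ b) * (u * v) ≡ (𝟙 a * u) * (𝟙 b * v)
𝟙-∧-*-interchange a b u v = trans (cong (_* (u * v)) (𝟙-∧ a b)) (*-interchange (𝟙 a) (𝟙 b) u v)

∧-interchange₄ : ∀ a₁ b₁ a₂ b₂ a₃ b₃ a₄ b₄ →
  (a₁ ∧ b₁) ∧ (a₂ ∧ b₂) ∧ (a₃ ∧ b₃) ∧ (a₄ ∧ b₄) ≡ (a₁ ∧ a₂ ∧ a₃ ∧ a₄) ∧ (b₁ ∧ b₂ ∧ b₃ ∧ b₄)
∧-interchange₄ a₁ b₁ a₂ b₂ a₃ b₃ a₄ b₄ = begin
  (a₁ ∧ b₁) ∧ (a₂ ∧ b₂) ∧ (a₃ ∧ b₃) ∧ (a₄ ∧ b₄)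
    ≡⟨ cong (λ t → (a₁ ∧ b₁) ∧ (a₂ ∧ b₂) ∧ t) (∧-interchange a₃ b₃ a₄ b₄) ⟩
  (a₁ ∧ b₁) ∧ (a₂ ∧ b₂) ∧ (a₃ ∧ a₄) ∧ (b₃ ∧ b₄)
    ≡⟨ cong ((a₁ ∧ b₁) ∧_) (∧-interchange a₂ b₂ (a₃ ∧ a₄) (b₃ ∧ b₄)) ⟩
  (a₁ ∧ b₁) ∧ (a₂ ∧ a₃ ∧ a₄) ∧ (b₂ ∧ b₃ ∧ b₄)
    ≡⟨ ∧-interchange a₁ b₁ (a₂ ∧ a₃ ∧ a₄) (b₂ ∧ b₃ ∧ b₄) ⟩
  (a₁ ∧ a₂ ∧ a₃ ∧ a₄) ∧ (b₁ ∧ b₂ ∧ b₃ ∧ b₄) ∎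

𝟙-does-* : ∀ {A : Set} (a? : Dec A) {u : ℤ} → A → 𝟙 (does a?) * u ≡ u
𝟙-does-* a? {u} a = trans (cong (λ b → 𝟙 b * u) (dec-true a? a)) (ℤ.*-identityˡ u)

𝟙-does-*-cong : ∀ {A : Set} (a? : Dec A) {u v : ℤ} → (A → u ≡ v) → 𝟙 (does a?) * u ≡ 𝟙 (does a?) * v
𝟙-does-*-cong (yes a) u≡v = cong (1ℤ *_) (u≡v a)
𝟙-does-*-cong (no _)  u≡v = refl

does⇒ : ∀ {A : Set} (a? : Dec A) → does a? ≡ true → A
does⇒ (yes a) _  = a
does⇒ (no _)  ()

≤-foldr-⊔ : ∀ {n} (f : Fin n → ℕ) i → f i ℕ.≤ foldr _⊔_ 0 f
≤-foldr-⊔ f zero    = ℕ.m≤m⊔n (f zero) _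
≤-foldr-⊔ f (suc i) = ℕ.≤-trans (≤-foldr-⊔ (f ∘ suc) i) (ℕ.m≤n⊔m (f zero) _)

foldr-⊔-lub : ∀ {n} (f : Fin n → ℕ) {c} → (∀ i → f i ℕ.≤ c) → foldr _⊔_ 0 f ℕ.≤ c
foldr-⊔-lub {ℕ.zero}  f f≤c = ℕ.z≤n
foldr-⊔-lub {ℕ.suc n} f f≤c = ℕ.⊔-lub (f≤c zero) (foldr-⊔-lub (f ∘ suc) (f≤c ∘ suc))

foldr-⊔-attained : ∀ {n} (f : Fin n → ℕ) → Fin n → ∃ λ i → foldr _⊔_ 0 f ≡ f i
foldr-⊔-attained {1} f _ = zero , ℕ.⊔-identityʳ (f zero)
foldr-⊔-attained {ℕ.suc (ℕ.suc n)} f _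
  with ℕ.⊔-sel (f zero) (foldr _⊔_ 0 (f ∘ suc)) | foldr-⊔-attained {ℕ.suc n} (f ∘ suc) zero
... | inj₁ max≡f₀   | _            = zero , max≡f₀
... | inj₂ max≡rest | i , rest≡fi = suc i , trans max≡rest rest≡fi

[m+n]∸[o+p]≡[m∸o]+[n∸p] : ∀ {m n o p} → o ℕ.≤ m → p ℕ.≤ n → (m ℕ.+ n) ∸ (o ℕ.+ p) ≡ (m ∸ o) ℕ.+ (n ∸ p)
[m+n]∸[o+p]≡[m∸o]+[n∸p] {m} {n} {o} {p} o≤m p≤n = begin
  (m ℕ.+ n) ∸ (o ℕ.+ p) ≡⟨ ℕ.∸-+-assoc (m ℕ.+ n) o p ⟨
  (m ℕ.+ n) ∸ o ∸ p     ≡⟨ cong (_∸ p) (ℕ.+-∸-comm n o≤m) ⟩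
  (m ∸ o) ℕ.+ n ∸ p     ≡⟨ ℕ.+-∸-assoc (m ∸ o) p≤n ⟩
  (m ∸ o) ℕ.+ (n ∸ p)   ∎

-- Polynomials as coefficient sequences

sumUpTo-cong : ∀ k {f g : ℕ → ℤ} → (∀ i → f i ≡ g i) → sumUpTo k f ≡ sumUpTo k g
sumUpTo-cong ℕ.zero    f≗g = f≗g 0
sumUpTo-cong (ℕ.suc k) f≗g = cong₂ _+_ (sumUpTo-cong k f≗g) (f≗g (ℕ.suc k))

sumUpTo≡sum : ∀ k (f : ℕ → ℤ) → sumUpTo k f ≡ sum λ (i : Fin (ℕ.suc k)) → f (toℕ i)
sumUpTo≡sum ℕ.zero    f = sym (ℤ.+-identityʳ (f 0))
sumUpTo≡sum (ℕ.suc k) f = begin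
  sumUpTo k f + f (ℕ.suc k)
    ≡⟨ cong₂ _+_ (trans (sumUpTo≡sum k f) (sum-cong-≗ λ (i : Fin (ℕ.suc k)) → cong f (sym (toℕ-inject₁ i))))
                 (cong f (sym (toℕ-fromℕ (ℕ.suc k)))) ⟩
  sum (λ (i : Fin (ℕ.suc k)) → f (toℕ (Fin.inject₁ i))) + f (toℕ (Fin.fromℕ (ℕ.suc k)))
    ≡⟨ sum-init-last {ℕ.suc k} (f ∘ toℕ) ⟨
  sum (λ (i : Fin (ℕ.suc (ℕ.suc k))) → f (toℕ i)) ∎

sumUpTo-δ : ∀ k a (f : ℕ → ℤ) → sumUpTo k (λ i → 𝟙 (does (i ℕ.≟ a)) * f i) ≡ 𝟙 (does (a ℕ.≤? k)) * f a
sumUpTo-δ k a f with a ℕ.≤? k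
... | yes a≤k = begin
  sumUpTo k g                           ≡⟨ sumUpTo≡sum k g ⟩
  sum (λ (i : Fin (ℕ.suc k)) → g (toℕ i)) ≡⟨ sum-single (g ∘ toℕ) a′ g≗0 ⟩
  g (toℕ a′)                            ≡⟨ cong g (toℕ-fromℕ< (ℕ.s≤s a≤k)) ⟩
  g a                                   ≡⟨ cong (λ b → 𝟙 b * f a) (dec-true (a ℕ.≟ a) refl) ⟩
  1ℤ * f a                              ≡⟨ cong (λ b → 𝟙 b * f a) (dec-true (a ℕ.≤? k) a≤k) ⟨
  𝟙 (does (a ℕ.≤? k)) * f a             ∎
  where
  g : ℕ → ℤ
  g i = 𝟙 (does (i ℕ.≟ a)) * f i
  a′ : Fin (ℕ.suc k)
  a′ = fromℕ< (ℕ.s≤s a≤k)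
  g≗0 : ∀ i → i ≢ a′ → g (toℕ i) ≡ 0ℤ
  g≗0 i i≢a′ = cong (λ b → 𝟙 b * f (toℕ i))
    (dec-false (toℕ i ℕ.≟ a) λ i≡a → i≢a′ (toℕ-injective (trans i≡a (sym (toℕ-fromℕ< (ℕ.s≤s a≤k))))))
... | no a≰k = begin
  sumUpTo k (λ i → 𝟙 (does (i ℕ.≟ a)) * f i) ≡⟨ sumUpTo≡sum k _ ⟩
  sum (λ (i : Fin (ℕ.suc k)) → 𝟙 (does (toℕ i ℕ.≟ a)) * f (toℕ i))
    ≡⟨ sum-zero (λ i → cong (λ b → 𝟙 b * f (toℕ i))
         (dec-false (toℕ i ℕ.≟ a) λ i≡a → a≰k (subst (ℕ._≤ k) i≡a (toℕ≤pred[n] i)))) ⟩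
  0ℤ                                         ≡⟨ cong (λ b → 𝟙 b * f a) (dec-false (a ℕ.≤? k) a≰k) ⟨
  𝟙 (does (a ℕ.≤? k)) * f a                  ∎

≤×∸≡⇔≡+ : ∀ {a b k} → (a ℕ.≤ k × k ∸ a ≡ b) ⇔ k ≡ a ℕ.+ b
≤×∸≡⇔≡+ {a} {b} = mk⇔
  (λ (a≤k , k∸a≡b) → trans (sym (ℕ.m+[n∸m]≡n a≤k)) (cong (a ℕ.+_) k∸a≡b))
  (λ { refl → ℕ.m≤m+n a b , ℕ.m+n∸m≡n a b })

monomial : ℕ → ℤ → ℕ → ℤ
monomial d c k = 𝟙 (does (k ℕ.≟ d)) * c

monomial-⊛ : ∀ a b c d k → (monomial a c ⊛ monomial b d) k ≡ monomial (a ℕ.+ b) (c * d) k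
monomial-⊛ a b c d k = begin
  sumUpTo k (λ i → (𝟙 (does (i ℕ.≟ a)) * c) * (𝟙 (does (k ∸ i ℕ.≟ b)) * d))
    ≡⟨ sumUpTo-cong k (λ i → ℤ.*-assoc (𝟙 (does (i ℕ.≟ a))) c _) ⟩
  sumUpTo k (λ i → 𝟙 (does (i ℕ.≟ a)) * (c * (𝟙 (does (k ∸ i ℕ.≟ b)) * d)))
    ≡⟨ sumUpTo-δ k a _ ⟩
  𝟙 (does (a ℕ.≤? k)) * (c * (𝟙 (does (k ∸ a ℕ.≟ b)) * d))
    ≡⟨ regroup (𝟙 (does (a ℕ.≤? k))) c (𝟙 (does (k ∸ a ℕ.≟ b))) d ⟩
  (𝟙 (does (a ℕ.≤? k)) * 𝟙 (does (k ∸ a ℕ.≟ b))) * (c * d)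
    ≡⟨ cong (_* (c * d)) (𝟙-∧ (does (a ℕ.≤? k)) (does (k ∸ a ℕ.≟ b))) ⟨
  𝟙 (does ((a ℕ.≤? k) ×-dec (k ∸ a ℕ.≟ b))) * (c * d)
    ≡⟨ cong (λ t → 𝟙 t * (c * d)) (does-⇔ ≤×∸≡⇔≡+ ((a ℕ.≤? k) ×-dec (k ∸ a ℕ.≟ b)) (k ℕ.≟ a ℕ.+ b)) ⟩
  𝟙 (does (k ℕ.≟ a ℕ.+ b)) * (c * d) ∎
  where
  regroup : ∀ x c y d → x * (c * (y * d)) ≡ (x * y) * (c * d)
  regroup = solve-∀

⊛-cong : ∀ {p p′ q q′ : ℕ → ℤ} → (∀ i → p i ≡ p′ i) → (∀ i → q i ≡ q′ i) → ∀ k → (p ⊛ q) k ≡ (p′ ⊛ q′) k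
⊛-cong p≗p′ q≗q′ k = sumUpTo-cong k λ i → cong₂ _*_ (p≗p′ i) (q≗q′ (k ∸ i))

sum-⊛-sum : ∀ {m n} (f : Fin m → ℕ → ℤ) (g : Fin n → ℕ → ℤ) k →
  ((λ l → sum λ i → f i l) ⊛ (λ l → sum λ j → g j l)) k ≡ sum λ i → sum λ j → (f i ⊛ g j) k
sum-⊛-sum f g k = begin
  sumUpTo k (λ l → sum (λ i → f i l) * sum (λ j → g j (k ∸ l)))
    ≡⟨ sumUpTo-cong k (λ l → sum-*-sum (λ i → f i l) (λ j → g j (k ∸ l))) ⟩
  sumUpTo k (λ l → sum λ i → sum λ j → f i l * g j (k ∸ l))
    ≡⟨ sumUpTo≡sum k _ ⟩
  sum (λ (l : Fin (ℕ.suc k)) → sum λ i → sum λ j → f i (toℕ l) * g j (k ∸ toℕ l))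
    ≡⟨ ∑-comm (λ (l : Fin (ℕ.suc k)) i → sum λ j → f i (toℕ l) * g j (k ∸ toℕ l)) ⟩
  sum (λ i → sum λ (l : Fin (ℕ.suc k)) → sum λ j → f i (toℕ l) * g j (k ∸ toℕ l))
    ≡⟨ sum-cong-≗ (λ i → ∑-comm (λ l j → f i (toℕ {ℕ.suc k} l) * g j (k ∸ toℕ l))) ⟩
  sum (λ i → sum λ j → sum λ (l : Fin (ℕ.suc k)) → f i (toℕ l) * g j (k ∸ toℕ l))
    ≡⟨ sum-cong-≗ (λ i → sum-cong-≗ λ j → sumUpTo≡sum k (λ l → f i l * g j (k ∸ l))) ⟨
  sum (λ i → sum λ j → (f i ⊛ g j) k) ∎

∑³-⊛-∑³ : ∀ {m n} (f : Fin m → Fin m → Fin m → ℕ → ℤ) (g : Fin n → Fin n → Fin n → ℕ → ℤ) k →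
  ((λ l → ∑³ λ x y z → f x y z l) ⊛ (λ l → ∑³ λ x′ y′ z′ → g x′ y′ z′ l)) k
  ≡ ∑³⊗ λ x y z x′ y′ z′ → (f x y z ⊛ g x′ y′ z′) k
∑³-⊛-∑³ f g k = begin
  ((λ l → ∑³ λ x y z → f x y z l) ⊛ (λ l → ∑³ λ x′ y′ z′ → g x′ y′ z′ l)) k
    ≡⟨ sum-⊛-sum (λ x l → sum λ y → sum λ z → f x y z l) (λ x′ l → sum λ y′ → sum λ z′ → g x′ y′ z′ l) k ⟩
  sum (λ x → sum λ x′ → ((λ l → sum λ y → sum λ z → f x y z l) ⊛ (λ l → sum λ y′ → sum λ z′ → g x′ y′ z′ l)) k)
    ≡⟨ sum-cong-≗ (λ x → sum-cong-≗ λ x′ →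
         sum-⊛-sum (λ y l → sum λ z → f x y z l) (λ y′ l → sum λ z′ → g x′ y′ z′ l) k) ⟩
  sum (λ x → sum λ x′ → sum λ y → sum λ y′ → ((λ l → sum λ z → f x y z l) ⊛ (λ l → sum λ z′ → g x′ y′ z′ l)) k)
    ≡⟨ sum-cong-≗ (λ x → sum-cong-≗ λ x′ → sum-cong-≗ λ y → sum-cong-≗ λ y′ →
         sum-⊛-sum (f x y) (g x′ y′) k) ⟩
  ∑³⊗ (λ x y z x′ y′ z′ → (f x y z ⊛ g x′ y′ z′) k) ∎

-- M as a sum of monomials

module _ (S : FinPosetData) where
  open FinPosetData S

  exponent : Fin size → Fin size → Fin size → ℕ
  exponent x y z = 3 ℕ.* rank S ∸ (rk x ℕ.+ rk y ℕ.+ rk z)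

  flag? : ∀ x y z → Dec (x ≤ y × y ≤ z)
  flag? x y z = (x ≤? y) ×-dec (y ≤? z)

  box? : ∀ x y z a b → Dec (x ≤ a × a ≤ y × y ≤ b × b ≤ z)
  box? x y z a b = (x ≤? a) ×-dec (a ≤? y) ×-dec (y ≤? b) ×-dec (b ≤? z)

  restrictToFlags : (Fin size → Fin size → Fin size → ℤ) → Fin size → Fin size → Fin size → ℤ
  restrictToFlags J x y z = 𝟙 (does (flag? x y z)) * J x y z

  M≡∑³-monomial : ∀ J k → M S J k ≡ ∑³ λ x y z → monomial (exponent x y z) (restrictToFlags J x y z) k
  M≡∑³-monomial J k = ∑³-cong λ x y z → begin
    𝟙 (does (x ≤? y) ∧ does (y ≤? z) ∧ does (k ℕ.≟ exponent x y z)) * J x y z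
      ≡⟨ cong (_* J x y z) (trans (cong 𝟙 (sym (∧-assoc (does (x ≤? y)) (does (y ≤? z)) (does (k ℕ.≟ exponent x y z)))))
                                   (𝟙-∧ (does (flag? x y z)) (does (k ℕ.≟ exponent x y z)))) ⟩
    (𝟙 (does (flag? x y z)) * 𝟙 (does (k ℕ.≟ exponent x y z))) * J x y z
      ≡⟨ xy∙z≈y∙xz (𝟙 (does (flag? x y z))) (𝟙 (does (k ℕ.≟ exponent x y z))) (J x y z) ⟩
    𝟙 (does (k ℕ.≟ exponent x y z)) * restrictToFlags J x y z ∎

  rk+rk+rk≤3*rank : ∀ x y z → rk x ℕ.+ rk y ℕ.+ rk z ℕ.≤ 3 ℕ.* rank S
  rk+rk+rk≤3*rank x y z = ℕ.≤-trans
    (ℕ.+-mono-≤ (ℕ.+-mono-≤ (≤-foldr-⊔ rk x) (≤-foldr-⊔ rk y)) (≤-foldr-⊔ rk z))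
    (ℕ.≤-reflexive (triple (rank S)))
    where
    triple : ∀ r → r ℕ.+ r ℕ.+ r ≡ 3 ℕ.* r
    triple = ℕ-Solver.solve-∀

-- Uniqueness of J

module _ (S : FinPosetData) (isPO : IsPartialOrder _≡_ (FinPosetData._≤_ S)) where
  open FinPosetData S
  open IsPartialOrder isPO using (antisym) renaming (refl to ≤-refl; trans to ≤-trans)

  ⟦_,_⟧ : Fin size → Fin size → Subset size
  ⟦ x , y ⟧ = tabulate λ a → does ((x ≤? a) ×-dec (a ≤? y))

  ∈⟦⟧⁺ : ∀ {x y a} → x ≤ a → a ≤ y → a ∈ ⟦ x , y ⟧
  ∈⟦⟧⁺ {x} {y} {a} x≤a a≤y = lookup⇒[]= a ⟦ x , y ⟧
    (trans (lookup∘tabulate _ a) (dec-true ((x ≤? a) ×-dec (a ≤? y)) (x≤a , a≤y)))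

  ∈⟦⟧⁻ : ∀ {x y a} → a ∈ ⟦ x , y ⟧ → x ≤ a × a ≤ y
  ∈⟦⟧⁻ {x} {y} {a} a∈ = does⇒ ((x ≤? a) ×-dec (a ≤? y)) (trans (sym (lookup∘tabulate _ a)) ([]=⇒lookup a∈))

  ⟦⟧-⊆ˡ : ∀ {x a y} → x ≤ a → ⟦ a , y ⟧ ⊆ ⟦ x , y ⟧
  ⟦⟧-⊆ˡ x≤a c∈ = ∈⟦⟧⁺ (≤-trans x≤a (proj₁ (∈⟦⟧⁻ c∈))) (proj₂ (∈⟦⟧⁻ c∈))

  ⟦⟧-⊆ʳ : ∀ {y b z} → b ≤ z → ⟦ y , b ⟧ ⊆ ⟦ y , z ⟧
  ⟦⟧-⊆ʳ b≤z c∈ = ∈⟦⟧⁺ (proj₁ (∈⟦⟧⁻ c∈)) (≤-trans (proj₂ (∈⟦⟧⁻ c∈)) b≤z)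

  ⟦⟧-⊂ˡ : ∀ {x a y} → x ≤ a → a ≤ y → a ≢ x → ⟦ a , y ⟧ ⊂ ⟦ x , y ⟧
  ⟦⟧-⊂ˡ {x} x≤a a≤y a≢x =
    ⟦⟧-⊆ˡ x≤a , x , ∈⟦⟧⁺ ≤-refl (≤-trans x≤a a≤y) , λ x∈ → a≢x (antisym (proj₁ (∈⟦⟧⁻ x∈)) x≤a)

  ⟦⟧-⊂ʳ : ∀ {y b z} → y ≤ b → b ≤ z → b ≢ z → ⟦ y , b ⟧ ⊂ ⟦ y , z ⟧
  ⟦⟧-⊂ʳ {z = z} y≤b b≤z b≢z =
    ⟦⟧-⊆ʳ b≤z , z , ∈⟦⟧⁺ (≤-trans y≤b b≤z) ≤-refl , λ z∈ → b≢z (antisym b≤z (proj₂ (∈⟦⟧⁻ z∈)))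

  IsJ-unique : ∀ {J J′} → IsJ S J → IsJ S J′ → ∀ x y z → x ≤ y → y ≤ z → J x y z ≡ J′ x y z
  IsJ-unique {J} {J′} isJ isJ′ x y z = All.wfRec (On.wellFounded μ <-wellFounded) 0ℓ Agree agree (x , z)
    where
    μ : Fin size × Fin size → ℕ
    μ (a , b) = ∣ ⟦ a , y ⟧ ∣ ℕ.+ ∣ ⟦ y , b ⟧ ∣

    Agree : Fin size × Fin size → Set
    Agree (a , b) = a ≤ y → y ≤ b → J a y b ≡ J′ a y b

    agree : ∀ xz → WfRec (ℕ._<_ on μ) Agree xz → Agree xz
    agree (x , z) ih x≤y y≤z = begin
      J x y z   ≡⟨ 𝟙-does-* (box? S x y z x z) corner∈box ⟨
      F x z     ≡⟨ sum≡sum⇒≡-at (F x) (F′ x) z (λ b b≢z → F≡F′-off x b (inj₂ b≢z)) rows ⟩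
      F′ x z    ≡⟨ 𝟙-does-* (box? S x y z x z) corner∈box ⟩
      J′ x y z  ∎
      where
      F F′ : Fin size → Fin size → ℤ
      F  a b = 𝟙 (does (box? S x y z a b)) * J a y b
      F′ a b = 𝟙 (does (box? S x y z a b)) * J′ a y b

      corner∈box : x ≤ x × x ≤ y × y ≤ z × z ≤ z
      corner∈box = ≤-refl , x≤y , y≤z , ≤-refl

      shrinks : ∀ {a b} → x ≤ a → a ≤ y → y ≤ b → b ≤ z → a ≢ x ⊎ b ≢ z → μ (a , b) ℕ.< μ (x , z)
      shrinks x≤a a≤y y≤b b≤z (inj₁ a≢x) =
        ℕ.+-mono-<-≤ (p⊂q⇒∣p∣<∣q∣ (⟦⟧-⊂ˡ x≤a a≤y a≢x)) (p⊆q⇒∣p∣≤∣q∣ (⟦⟧-⊆ʳ b≤z))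
      shrinks x≤a a≤y y≤b b≤z (inj₂ b≢z) =
        ℕ.+-mono-≤-< (p⊆q⇒∣p∣≤∣q∣ (⟦⟧-⊆ˡ x≤a)) (p⊂q⇒∣p∣<∣q∣ (⟦⟧-⊂ʳ y≤b b≤z b≢z))

      F≡F′-off : ∀ a b → a ≢ x ⊎ b ≢ z → F a b ≡ F′ a b
      F≡F′-off a b off = 𝟙-does-*-cong (box? S x y z a b) λ (x≤a , a≤y , y≤b , b≤z) →
        ih (shrinks x≤a a≤y y≤b b≤z off) a≤y y≤b

      rows : sum (F x) ≡ sum (F′ x)
      rows = sum≡sum⇒≡-at (λ a → sum (F a)) (λ a → sum (F′ a)) x
        (λ a a≢x → sum-cong-≗ λ b → F≡F′-off a b (inj₁ a≢x))
        (trans (isJ x y z x≤y y≤z) (sym (isJ′ x y z x≤y y≤z)))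

-- Products

module _ (P Q : FinPosetData) where
  private
    module P = FinPosetData P
    module Q = FinPosetData Q
    module PQ = FinPosetData (P ⊗ Q)

    p : Fin PQ.size → Fin P.size
    p = π₁ {P.size} {Q.size}
    q : Fin PQ.size → Fin Q.size
    q = π₂ {P.size} {Q.size}

  ≡⇔π≡ : ∀ {u v} → u ≡ v ⇔ (p u ≡ p v × q u ≡ q v)
  ≡⇔π≡ {u} {v} = mk⇔ (λ { refl → refl , refl }) λ pu≡pv,qu≡qv → begin
    u                                           ≡⟨ combine-remQuot {P.size} Q.size u ⟨
    uncurry combine (remQuot {P.size} Q.size u) ≡⟨ cong (uncurry combine) (×-≡,≡→≡ pu≡pv,qu≡qv) ⟩
    uncurry combine (remQuot {P.size} Q.size v) ≡⟨ combine-remQuot {P.size} Q.size v ⟩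
    v                                           ∎

  ⊗-isPartialOrder : IsPartialOrder _≡_ P._≤_ → IsPartialOrder _≡_ Q._≤_ → IsPartialOrder _≡_ PQ._≤_
  ⊗-isPartialOrder isPO-P isPO-Q = record
    { isPreorder = record
      { isEquivalence = isEquivalence
      ; reflexive     = λ { refl → ≤P.refl , ≤Q.refl }
      ; trans         = λ (u≤v₁ , u≤v₂) (v≤w₁ , v≤w₂) → ≤P.trans u≤v₁ v≤w₁ , ≤Q.trans u≤v₂ v≤w₂
      }
    ; antisym = λ (u≤v₁ , u≤v₂) (v≤u₁ , v≤u₂) → Equivalence.from ≡⇔π≡ (≤P.antisym u≤v₁ v≤u₁ , ≤Q.antisym u≤v₂ v≤u₂)
    }
    where
    module ≤P = IsPartialOrder isPO-P
    module ≤Q = IsPartialOrder isPO-Q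

  δ₃-⊗ : ∀ x y z → δ₃ (P ⊗ Q) x y z ≡ δ₃ P (p x) (p y) (p z) * δ₃ Q (q x) (q y) (q z)
  δ₃-⊗ x y z = begin
    𝟙 (does (x ≟ y) ∧ does (y ≟ z))
      ≡⟨ cong₂ (λ s t → 𝟙 (s ∧ t)) (does-≟ x y) (does-≟ y z) ⟩
    𝟙 ((does (p x ≟ p y) ∧ does (q x ≟ q y)) ∧ (does (p y ≟ p z) ∧ does (q y ≟ q z)))
      ≡⟨ cong 𝟙 (∧-interchange (does (p x ≟ p y)) (does (q x ≟ q y)) (does (p y ≟ p z)) (does (q y ≟ q z))) ⟩
    𝟙 ((does (p x ≟ p y) ∧ does (p y ≟ p z)) ∧ (does (q x ≟ q y) ∧ does (q y ≟ q z)))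
      ≡⟨ 𝟙-∧ (does (p x ≟ p y) ∧ does (p y ≟ p z)) (does (q x ≟ q y) ∧ does (q y ≟ q z)) ⟩
    δ₃ P (p x) (p y) (p z) * δ₃ Q (q x) (q y) (q z) ∎
    where
    does-≟ : ∀ u v → does (u ≟ v) ≡ does (p u ≟ p v) ∧ does (q u ≟ q v)
    does-≟ u v = does-⇔ ≡⇔π≡ (u ≟ v) ((p u ≟ p v) ×-dec (q u ≟ q v))

  _⊠_ : (Fin P.size → Fin P.size → Fin P.size → ℤ) → (Fin Q.size → Fin Q.size → Fin Q.size → ℤ) →
        Fin PQ.size → Fin PQ.size → Fin PQ.size → ℤ
  (JP ⊠ JQ) u v w = JP (p u) (p v) (p w) * JQ (q u) (q v) (q w)

  IsJ-⊗ : ∀ {JP JQ} → IsJ P JP → IsJ Q JQ → IsJ (P ⊗ Q) (JP ⊠ JQ)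
  IsJ-⊗ {JP} {JQ} isJP isJQ x y z (x≤y₁ , x≤y₂) (y≤z₁ , y≤z₂) = begin
    sum (λ u → sum λ w → 𝟙 (does (box? (P ⊗ Q) x y z u w)) * (JP ⊠ JQ) u y w)
      ≡⟨ sum-cong-≗ (λ u → sum-cong-≗ λ w → box-⊗ u w) ⟩
    sum (λ u → sum λ w → A (p u) (p w) * B (q u) (q w))
      ≡⟨ sum-cong-≗ (λ u → sum-remQuot λ b b′ → A (p u) b * B (q u) b′) ⟩
    sum (λ u → sum λ b → sum λ b′ → A (p u) b * B (q u) b′)
      ≡⟨ sum-remQuot (λ a a′ → sum λ b → sum λ b′ → A a b * B a′ b′) ⟩
    sum (λ a → sum λ a′ → sum λ b → sum λ b′ → A a b * B a′ b′)
      ≡⟨ sum-cong-≗ (λ a → sum-cong-≗ λ a′ → sum-*-sum (A a) (B a′)) ⟨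
    sum (λ a → sum λ a′ → sum (A a) * sum (B a′))
      ≡⟨ sum-*-sum (λ a → sum (A a)) (λ a′ → sum (B a′)) ⟨
    sum (λ a → sum (A a)) * sum (λ a′ → sum (B a′))
      ≡⟨ cong₂ _*_ (isJP (p x) (p y) (p z) x≤y₁ y≤z₁) (isJQ (q x) (q y) (q z) x≤y₂ y≤z₂) ⟩
    δ₃ P (p x) (p y) (p z) * δ₃ Q (q x) (q y) (q z)
      ≡⟨ δ₃-⊗ x y z ⟨
    δ₃ (P ⊗ Q) x y z ∎
    where
    A : Fin P.size → Fin P.size → ℤ
    A a b = 𝟙 (does (box? P (p x) (p y) (p z) a b)) * JP a (p y) b
    B : Fin Q.size → Fin Q.size → ℤ
    B a b = 𝟙 (does (box? Q (q x) (q y) (q z) a b)) * JQ a (q y) b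

    box-⊗ : ∀ u w → 𝟙 (does (box? (P ⊗ Q) x y z u w)) * (JP ⊠ JQ) u y w ≡ A (p u) (p w) * B (q u) (q w)
    box-⊗ u w = trans
      (cong (λ t → 𝟙 t * (JP ⊠ JQ) u y w)
        (∧-interchange₄ (does (p x P.≤? p u)) (does (q x Q.≤? q u)) (does (p u P.≤? p y)) (does (q u Q.≤? q y))
                        (does (p y P.≤? p w)) (does (q y Q.≤? q w)) (does (p w P.≤? p z)) (does (q w Q.≤? q z))))
      (𝟙-∧-*-interchange (does (box? P (p x) (p y) (p z) (p u) (p w))) (does (box? Q (q x) (q y) (q z) (q u) (q w)))
                         (JP (p u) (p y) (p w)) (JQ (q u) (q y) (q w)))

  restrictToFlags-⊗ : ∀ {JP JQ JPQ} → IsPartialOrder _≡_ P._≤_ → IsPartialOrder _≡_ Q._≤_ →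
    IsJ P JP → IsJ Q JQ → IsJ (P ⊗ Q) JPQ → ∀ u v w →
    restrictToFlags (P ⊗ Q) JPQ u v w ≡ restrictToFlags P JP (p u) (p v) (p w) * restrictToFlags Q JQ (q u) (q v) (q w)
  restrictToFlags-⊗ {JP} {JQ} {JPQ} isPO-P isPO-Q isJP isJQ isJPQ u v w = begin
    𝟙 (does (flag? (P ⊗ Q) u v w)) * JPQ u v w
      ≡⟨ 𝟙-does-*-cong (flag? (P ⊗ Q) u v w) (λ (u≤v , v≤w) →
           IsJ-unique (P ⊗ Q) (⊗-isPartialOrder isPO-P isPO-Q) isJPQ (IsJ-⊗ isJP isJQ) u v w u≤v v≤w) ⟩
    𝟙 (does (flag? (P ⊗ Q) u v w)) * (JP ⊠ JQ) u v w
      ≡⟨ cong (λ t → 𝟙 t * (JP ⊠ JQ) u v w)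
           (∧-interchange (does (p u P.≤? p v)) (does (q u Q.≤? q v)) (does (p v P.≤? p w)) (does (q v Q.≤? q w))) ⟩
    𝟙 ((does (p u P.≤? p v) ∧ does (p v P.≤? p w)) ∧ (does (q u Q.≤? q v) ∧ does (q v Q.≤? q w))) * (JP ⊠ JQ) u v w
      ≡⟨ 𝟙-∧-*-interchange (does (flag? P (p u) (p v) (p w))) (does (flag? Q (q u) (q v) (q w)))
                           (JP (p u) (p v) (p w)) (JQ (q u) (q v) (q w)) ⟩
    restrictToFlags P JP (p u) (p v) (p w) * restrictToFlags Q JQ (q u) (q v) (q w) ∎

  -- The two elements only witness nonemptiness: for empty P, rank (P ⊗ Q) is 0
  -- whatever rank Q is.
  rank-⊗ : Fin P.size → Fin Q.size → rank (P ⊗ Q) ≡ rank P ℕ.+ rank Q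
  rank-⊗ x₀ y₀ with foldr-⊔-attained P.rk x₀ | foldr-⊔-attained Q.rk y₀
  ... | i , rankP≡rk-i | j , rankQ≡rk-j = ℕ.≤-antisym
    (foldr-⊔-lub PQ.rk λ u → ℕ.+-mono-≤ (≤-foldr-⊔ P.rk (p u)) (≤-foldr-⊔ Q.rk (q u)))
    (subst (ℕ._≤ rank (P ⊗ Q)) rk-ij≡ranks (≤-foldr-⊔ PQ.rk (combine i j)))
    where
    rk-ij≡ranks : PQ.rk (combine i j) ≡ rank P ℕ.+ rank Q
    rk-ij≡ranks = trans (cong (λ (i′ , j′) → P.rk i′ ℕ.+ Q.rk j′) (remQuot-combine i j))
                        (sym (cong₂ ℕ._+_ rankP≡rk-i rankQ≡rk-j))

  exponent-⊗ : ∀ u v w → exponent (P ⊗ Q) u v w ≡ exponent P (p u) (p v) (p w) ℕ.+ exponent Q (q u) (q v) (q w)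
  exponent-⊗ u v w = begin
    3 ℕ.* rank (P ⊗ Q) ∸ (PQ.rk u ℕ.+ PQ.rk v ℕ.+ PQ.rk w)
      ≡⟨ cong (λ r → 3 ℕ.* r ∸ (PQ.rk u ℕ.+ PQ.rk v ℕ.+ PQ.rk w)) (rank-⊗ (p u) (q u)) ⟩
    3 ℕ.* (rank P ℕ.+ rank Q) ∸ (PQ.rk u ℕ.+ PQ.rk v ℕ.+ PQ.rk w)
      ≡⟨ cong₂ _∸_ (ℕ.*-distribˡ-+ 3 (rank P) (rank Q))
                   (regroup (P.rk (p u)) (Q.rk (q u)) (P.rk (p v)) (Q.rk (q v)) (P.rk (p w)) (Q.rk (q w))) ⟩
    (3 ℕ.* rank P ℕ.+ 3 ℕ.* rank Q) ∸ ((P.rk (p u) ℕ.+ P.rk (p v) ℕ.+ P.rk (p w)) ℕ.+ (Q.rk (q u) ℕ.+ Q.rk (q v) ℕ.+ Q.rk (q w)))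
      ≡⟨ [m+n]∸[o+p]≡[m∸o]+[n∸p] (rk+rk+rk≤3*rank P (p u) (p v) (p w)) (rk+rk+rk≤3*rank Q (q u) (q v) (q w)) ⟩
    exponent P (p u) (p v) (p w) ℕ.+ exponent Q (q u) (q v) (q w) ∎
    where
    regroup : ∀ a₁ b₁ a₂ b₂ a₃ b₃ →
      (a₁ ℕ.+ b₁) ℕ.+ (a₂ ℕ.+ b₂) ℕ.+ (a₃ ℕ.+ b₃) ≡ (a₁ ℕ.+ a₂ ℕ.+ a₃) ℕ.+ (b₁ ℕ.+ b₂ ℕ.+ b₃)
    regroup = ℕ-Solver.solve-∀

  M-⊗ : ∀ {JP JQ JPQ} → IsPartialOrder _≡_ P._≤_ → IsPartialOrder _≡_ Q._≤_ →
    IsJ P JP → IsJ Q JQ → IsJ (P ⊗ Q) JPQ → ∀ k →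
    M (P ⊗ Q) JPQ k ≡ ∑³⊗ λ x y z x′ y′ z′ →
      monomial (exponent P x y z ℕ.+ exponent Q x′ y′ z′) (restrictToFlags P JP x y z * restrictToFlags Q JQ x′ y′ z′) k
  M-⊗ {JP} {JQ} {JPQ} isPO-P isPO-Q isJP isJQ isJPQ k = begin
    M (P ⊗ Q) JPQ k
      ≡⟨ M≡∑³-monomial (P ⊗ Q) JPQ k ⟩
    ∑³ (λ u v w → monomial (exponent (P ⊗ Q) u v w) (restrictToFlags (P ⊗ Q) JPQ u v w) k)
      ≡⟨ ∑³-cong (λ u v w → cong₂ (λ e c → monomial e c k)
           (exponent-⊗ u v w) (restrictToFlags-⊗ isPO-P isPO-Q isJP isJQ isJPQ u v w)) ⟩
    ∑³ (λ u v w → monomial (exponent P (p u) (p v) (p w) ℕ.+ exponent Q (q u) (q v) (q w))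
                           (restrictToFlags P JP (p u) (p v) (p w) * restrictToFlags Q JQ (q u) (q v) (q w)) k)
      ≡⟨ ∑³-remQuot (λ x y z x′ y′ z′ →
           monomial (exponent P x y z ℕ.+ exponent Q x′ y′ z′) (restrictToFlags P JP x y z * restrictToFlags Q JQ x′ y′ z′) k) ⟩
    ∑³⊗ (λ x y z x′ y′ z′ →
      monomial (exponent P x y z ℕ.+ exponent Q x′ y′ z′) (restrictToFlags P JP x y z * restrictToFlags Q JQ x′ y′ z′) k) ∎

proposition6p6 : (P Q : FinPosetData) → IsRankedPoset P → IsRankedPoset Q →
    (JP : Fin (FinPosetData.size P) → Fin (FinPosetData.size P) → Fin (FinPosetData.size P) → ℤ) →
    (JQ : Fin (FinPosetData.size Q) → Fin (FinPosetData.size Q) → Fin (FinPosetData.size Q) → ℤ) →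
    (JPQ : Fin (FinPosetData.size (P ⊗ Q)) → Fin (FinPosetData.size (P ⊗ Q)) → Fin (FinPosetData.size (P ⊗ Q)) → ℤ) →
    IsJ P JP → IsJ Q JQ → IsJ (P ⊗ Q) JPQ →
    ∀ (k : ℕ) → M (P ⊗ Q) JPQ k ≡ (M P JP ⊛ M Q JQ) k
proposition6p6 P Q (isPO-P , _) (isPO-Q , _) JP JQ JPQ isJP isJQ isJPQ k = begin
  M (P ⊗ Q) JPQ k
    ≡⟨ M-⊗ P Q isPO-P isPO-Q isJP isJQ isJPQ k ⟩
  ∑³⊗ (λ x y z x′ y′ z′ → monomial (eP x y z ℕ.+ eQ x′ y′ z′) (wP x y z * wQ x′ y′ z′) k)
    ≡⟨ ∑³⊗-cong (λ x y z x′ y′ z′ → monomial-⊛ (eP x y z) (eQ x′ y′ z′) (wP x y z) (wQ x′ y′ z′) k) ⟨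
  ∑³⊗ (λ x y z x′ y′ z′ → (monomial (eP x y z) (wP x y z) ⊛ monomial (eQ x′ y′ z′) (wQ x′ y′ z′)) k)
    ≡⟨ ∑³-⊛-∑³ (λ x y z → monomial (eP x y z) (wP x y z)) (λ x′ y′ z′ → monomial (eQ x′ y′ z′) (wQ x′ y′ z′)) k ⟨
  ((λ l → ∑³ λ x y z → monomial (eP x y z) (wP x y z) l) ⊛ (λ l → ∑³ λ x′ y′ z′ → monomial (eQ x′ y′ z′) (wQ x′ y′ z′) l)) k
    ≡⟨ ⊛-cong (M≡∑³-monomial P JP) (M≡∑³-monomial Q JQ) k ⟨
  (M P JP ⊛ M Q JQ) k ∎
  where
  eP : Fin (FinPosetData.size P) → Fin (FinPosetData.size P) → Fin (FinPosetData.size P) → ℕ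
  eP = exponent P
  eQ : Fin (FinPosetData.size Q) → Fin (FinPosetData.size Q) → Fin (FinPosetData.size Q) → ℕ
  eQ = exponent Q
  wP : Fin (FinPosetData.size P) → Fin (FinPosetData.size P) → Fin (FinPosetData.size P) → ℤ
  wP = restrictToFlags P JP
  wQ : Fin (FinPosetData.size Q) → Fin (FinPosetData.size Q) → Fin (FinPosetData.size Q) → ℤ
  wQ = restrictToFlags Q JQ
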